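{- Let $n\ge 2$ and let $\sigma_1\neq\sigma_2$ be permutations in $S_n$. Suppose $\sigma_1^{ -1}\sigma_2$ is a product of $c$ disjoint cycles in $S_n$. Then the pair $P_{\sigma_1},P_{\sigma_2}$ is uniquely summable if and only if $c=1$. Furthermore, the matrix $P_{\sigma_1}+P_{\sigma_2}$ may be expressed in exactly $2^{c}$ ways as an ordered sum $P_{\tau_1}+P_{\tau_2}$ of two permutation matrices.
   Context: For $\sigma\in S_n$, $P_\sigma$ denotes the $n\times n$ permutation matrix of $\sigma$, with the convention $P_\sigma P_\tau=P_{\sigma\tau}$. A pair of distinct permutation matrices $P_{\sigma_1},P_{\sigma_2}$ is called uniquely summable if whenever $P_{\sigma_1}+P_{\sigma_2}=P_{\tau_1}+P_{\tau_2}$ for permutations $\tau_1,\tau_2$, we have either $\sigma_1=\tau_1,\sigma_2=\tau_2$, or $\sigma_1=\tau_2,\sigma_2=\tau_1$. In the cycle decomposition, $c$ counts the nontrivial cycles (fixed points are not counted as cycles). -}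

module Defs where

open import Data.Nat using (ℕ; zero; suc; _+_; _≤_; _≤?_)
open import Data.Fin using (Fin; toℕ; _≟_)
open import Data.Fin.Properties using (all?)
open import Data.Fin.Permutation using (Permutation′; _⟨$⟩ʳ_; _⟨$⟩ˡ_)
open import Data.List using (List; length; filter; map; allFin)
open import Data.List.Relation.Unary.All using (All)
open import Data.List.Relation.Unary.Any using (Any)
open import Data.List.Relation.Unary.AllPairs using (AllPairs)
open import Data.Product using (_×_; _,_)
open import Relation.Nullary using (¬_)
open import Relation.Nullary.Decidable using (_×-dec_; ¬?)
open import Relation.Binary.PropositionalEquality using (_≡_)

-- Permutation matrix P_σ with (P_σ)_{ij} = 1 iff i = σ(j), i.e. P_σ e_j = e_{σ(j)};
-- this gives P_σ P_τ = P_{στ} (στ = σ ∘ τ).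
P : ∀ {n} → Permutation′ n → Fin n → Fin n → ℕ
P σ i j with i ≟ (σ ⟨$⟩ʳ j)
... | Relation.Nullary.yes _ = 1
... | Relation.Nullary.no _ = 0

PSum : ∀ {n} → Permutation′ n → Permutation′ n → Fin n → Fin n → ℕ
PSum σ τ i j = P σ i j + P τ i j

_≐_ : ∀ {n} → (Fin n → Fin n → ℕ) → (Fin n → Fin n → ℕ) → Set
A ≐ B = ∀ i j → A i j ≡ B i j

_≈ₚ_ : ∀ {n} → Permutation′ n → Permutation′ n → Set
σ ≈ₚ τ = ∀ x → σ ⟨$⟩ʳ x ≡ τ ⟨$⟩ʳ x

UniquelySummable : ∀ {n} → Permutation′ n → Permutation′ n → Set
UniquelySummable {n} σ₁ σ₂ =
  ∀ (τ₁ τ₂ : Permutation′ n) → PSum σ₁ σ₂ ≐ PSum τ₁ τ₂ →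
    (σ₁ ≈ₚ τ₁ × σ₂ ≈ₚ τ₂) Data.Sum.⊎ (σ₁ ≈ₚ τ₂ × σ₂ ≈ₚ τ₁)
  where import Data.Sum

quot : ∀ {n} → Permutation′ n → Permutation′ n → Fin n → Fin n
quot σ₁ σ₂ i = σ₁ ⟨$⟩ˡ (σ₂ ⟨$⟩ʳ i)

iter : ∀ {n} → (Fin n → Fin n) → ℕ → Fin n → Fin n
iter f zero x = x
iter f (suc k) x = f (iter f k x)

-- number of nontrivial cycles of a permutation f of Fin n:
-- each cycle (orbit {f^k i}) of length ≥ 2 is counted once, via its least element
-- (i is not fixed and i ≤ f^k i for all k < n, which covers the whole orbit).
numCycles : ∀ {n} → (Fin n → Fin n) → ℕ
numCycles {n} f = length (filter
  (λ i → ¬? (f i ≟ i) ×-dec all? (λ (k : Fin n) → toℕ i ≤? toℕ (iter f (toℕ k) i)))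
  (allFin n))

-- "exactly k ways as an ordered sum P_τ₁ + P_τ₂": a list of k pairwise distinct
-- ordered pairs (τ₁ , τ₂), each a solution, containing every solution.
SamePair : ∀ {n} → Permutation′ n × Permutation′ n → Permutation′ n × Permutation′ n → Set
SamePair (a , b) (c , d) = a ≈ₚ c × b ≈ₚ d

ExactlyWays : ∀ {n} → ℕ → (Fin n → Fin n → ℕ) → Set
ExactlyWays {n} k M =
  Data.Product.Σ (List (Permutation′ n × Permutation′ n)) λ L →
    length L ≡ k
    × All (λ { (τ₁ , τ₂) → PSum τ₁ τ₂ ≐ M }) L
    × AllPairs (λ p q → ¬ SamePair p q) L
    × (∀ (τ₁ τ₂ : Permutation′ n) → PSum τ₁ τ₂ ≐ M → Any (SamePair (τ₁ , τ₂)) L)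
  where import Data.Product

-- Column j of P_τ₁ + P_τ₂ has its nonzero entries in rows τ₁ j and τ₂ j, so
-- P_τ₁ + P_τ₂ = P_σ₁ + P_σ₂ says exactly that every column j chooses which of
-- σ₁ j, σ₂ j is τ₁ j (the other one being τ₂ j).  Since σ₂ j = σ₁ (q j) for
-- q = σ₁⁻¹σ₂, injectivity of τ₁ and τ₂ forces the choice at a point moved by q
-- to agree with the choice at its image, so the choice is constant on every
-- nontrivial cycle of q and irrelevant at fixed points (where σ₁ j = σ₂ j).
-- Conversely every assignment of a side to each nontrivial cycle glues σ₁ and
-- σ₂ into a solution, and distinct assignments give distinct solutions; hence
-- there are exactly 2^c solutions, and (σ₁ , σ₂) and (σ₂ , σ₁) are the only
-- ones iff c = 1.
module Submission where

open import Defs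
open import Data.Bool using (Bool; true; false; not; if_then_else_)
open import Data.Empty using (⊥)
open import Data.Fin using (Fin; toℕ; fromℕ<; _≟_)
open import Data.Fin.Properties using (all?; toℕ-injective; toℕ-fromℕ<; toℕ<n; pigeonhole; ¬∀⟶∃¬)
open import Data.Fin.Permutation using (Permutation′; _⟨$⟩ʳ_; _⟨$⟩ˡ_; permutation; inverseˡ; inverseʳ; _∘ₚ_; flip)
open import Data.List using (List; []; _∷_; length; filter; map; allFin; applyUpTo; _++_)
open import Data.List.Extrema.Nat using (argmin; argmin-all; f[argmin]≤f[xs])
open import Data.List.Membership.Propositional using (_∈_)
open import Data.List.Membership.Propositional.Properties using (∈-filter⁺; ∈-filter⁻; ∈-allFin; ∈-applyUpTo⁺)
open import Data.List.Properties using (length-++; length-map)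
open import Data.List.Relation.Unary.All as All using (All)
import Data.List.Relation.Unary.All.Properties as All
open import Data.List.Relation.Unary.Any as Any using (Any; here; there)
import Data.List.Relation.Unary.Any.Properties as Any
open import Data.List.Relation.Unary.AllPairs as AllPairs using (AllPairs; []; _∷_)
import Data.List.Relation.Unary.AllPairs.Properties as AllPairs
open import Data.List.Relation.Unary.Unique.Propositional using (Unique)
import Data.List.Relation.Unary.Unique.Propositional.Properties as Unique
open import Data.Nat using (ℕ; zero; suc; _+_; _*_; _∸_; _^_; _≤_; _<_; _≤?_; s≤s⁻¹)
open import Data.Nat.Properties using (+-comm; +-identityʳ; +-cancelˡ-≡; ≤-trans; ≤-antisym; <⇒≤; n<1+n; m∸n≤m; m∸n+n≡m; m<n⇒0<n∸m)
open import Data.Nat.DivMod using (_%_; _/_; m≡m%n+[m/n]*n; m%n<n)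
open import Data.Product using (∃; _×_; _,_; proj₁; proj₂)
open import Data.Sum using (_⊎_; inj₁; inj₂)
open import Function using (_∘_)
open import Function.Bundles using (_⇔_; mk⇔; Injection)
open import Function.Definitions using (Injective)
open import Function.Properties.Inverse using (↔⇒↣)
open import Relation.Binary.Definitions using (DecidableEquality)
open import Relation.Binary.PropositionalEquality
open import Relation.Nullary using (¬_; Dec; yes; no; does; contradiction)
open import Relation.Nullary.Decidable using (_×-dec_; ¬?; dec-true; dec-false)

open ≡-Reasoning

private
  variable
    n : ℕ

⟨$⟩ʳ-injective : (π : Permutation′ n) → Injective _≡_ _≡_ (π ⟨$⟩ʳ_)
⟨$⟩ʳ-injective π = Injection.injective (↔⇒↣ π)

length≡1 : {A : Set} {xs : List A} {x : A} → Unique xs → x ∈ xs →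
  (∀ {a b} → a ∈ xs → b ∈ xs → ¬ a ≢ b) → length xs ≡ 1
length≡1 {xs = _ ∷ []} _ _ _ = refl
length≡1 {xs = a ∷ b ∷ _} ((a≢b All.∷ _) ∷ _) _ no-two =
  contradiction a≢b (no-two (here refl) (there (here refl)))

length≡1⇒singleton : {A : Set} (xs : List A) → length xs ≡ 1 → ∃ λ a → ∀ {x} → x ∈ xs → x ≡ a
length≡1⇒singleton (a ∷ []) _ = a , λ { (here x≡a) → x≡a }

-- Columns of permutation matrices

δ : Fin n → Fin n → ℕ
δ i a with i ≟ a
... | yes _ = 1
... | no _ = 0

δ-refl : (a : Fin n) → δ a a ≡ 1
δ-refl a with a ≟ a
... | yes _ = refl
... | no a≢a = contradiction refl a≢a

δ-≢ : {i a : Fin n} → i ≢ a → δ i a ≡ 0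
δ-≢ {i = i} {a} i≢a with i ≟ a
... | yes i≡a = contradiction i≡a i≢a
... | no _ = refl

δ≡1⇒≡ : {i a : Fin n} → δ i a ≡ 1 → i ≡ a
δ≡1⇒≡ {i = i} {a} eq with i ≟ a
... | yes i≡a = i≡a
δ≡1⇒≡ () | no _

δ-sum-injective : {a b c d : Fin n} → (∀ i → δ i a + δ i b ≡ δ i c + δ i d) →
  (a ≡ c × b ≡ d) ⊎ (a ≡ d × b ≡ c)
δ-sum-injective {a = a} {b} {c} {d} H with a ≟ c | a ≟ d
... | yes refl | _ = inj₁ (refl , sym (δ≡1⇒≡ (trans (+-cancelˡ-≡ (δ d a) _ _ (H d)) (δ-refl d))))
... | no _ | yes refl =
  inj₂ (refl , sym (δ≡1⇒≡ (trans (+-cancelˡ-≡ (δ c a) _ _ (trans (H c) (+-comm (δ c c) (δ c a)))) (δ-refl c))))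
... | no a≢c | no a≢d = contradiction 1+δ≡0 λ ()
  where
  1+δ≡0 : 1 + δ a b ≡ 0
  1+δ≡0 = begin
    1 + δ a b       ≡⟨ cong (_+ δ a b) (sym (δ-refl a)) ⟩
    δ a a + δ a b   ≡⟨ H a ⟩
    δ a c + δ a d   ≡⟨ cong₂ _+_ (δ-≢ a≢c) (δ-≢ a≢d) ⟩
    0               ∎

P≡δ : (σ : Permutation′ n) (i j : Fin n) → P σ i j ≡ δ i (σ ⟨$⟩ʳ j)
P≡δ σ i j with i ≟ (σ ⟨$⟩ʳ j)
... | yes _ = refl
... | no _ = refl

PSum≡δ+δ : (σ τ : Permutation′ n) (i j : Fin n) → PSum σ τ i j ≡ δ i (σ ⟨$⟩ʳ j) + δ i (τ ⟨$⟩ʳ j)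
PSum≡δ+δ σ τ i j = cong₂ _+_ (P≡δ σ i j) (P≡δ τ i j)

≐-sym : {A B : Fin n → Fin n → ℕ} → A ≐ B → B ≐ A
≐-sym A≐B i j = sym (A≐B i j)

-- Orbits of an injective map on Fin n

module _ (f : Fin n → Fin n) where

  iter-+ : ∀ a b x → iter f (a + b) x ≡ iter f a (iter f b x)
  iter-+ zero b x = refl
  iter-+ (suc a) b x = cong f (iter-+ a b x)

  iter-suc : ∀ k x → iter f k (f x) ≡ f (iter f k x)
  iter-suc zero x = refl
  iter-suc (suc k) x = cong f (iter-suc k x)

  iter-* : ∀ {p x} → iter f p x ≡ x → ∀ m → iter f (m * p) x ≡ x
  iter-* fixed zero = refl
  iter-* {p} {x} fixed (suc m) =
    trans (iter-+ p (m * p) x) (trans (cong (iter f p) (iter-* fixed m)) fixed)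

module Orbits (f : Fin n → Fin n) (f-injective : Injective _≡_ _≡_ f) where

  iter-injective : ∀ k → Injective _≡_ _≡_ (iter f k)
  iter-injective zero eq = eq
  iter-injective (suc k) eq = iter-injective k (f-injective eq)

  infix 4 _⇝_
  _⇝_ : Fin n → Fin n → Set
  x ⇝ y = ∃ λ k → iter f k x ≡ y

  ⇝-refl : ∀ {x} → x ⇝ x
  ⇝-refl = 0 , refl

  ⇝-step : ∀ {x} → x ⇝ f x
  ⇝-step = 1 , refl

  ⇝-trans : ∀ {x y z} → x ⇝ y → y ⇝ z → x ⇝ z
  ⇝-trans {x} (k , refl) (m , refl) = m + k , iter-+ f m k x

  period : ∀ x → ∃ λ p → 0 < p × p ≤ n × iter f p x ≡ x
  period x with i , j , i<j , iᵢ≡iⱼ ← pigeonhole (n<1+n n) (λ (i : Fin (suc n)) → iter f (toℕ i) x) =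
    d , m<n⇒0<n∸m i<j , ≤-trans (m∸n≤m (toℕ j) (toℕ i)) (s≤s⁻¹ (toℕ<n j)) ,
    iter-injective (toℕ i) shifted
    where
    d = toℕ j ∸ toℕ i
    shifted : iter f (toℕ i) (iter f d x) ≡ iter f (toℕ i) x
    shifted = begin
      iter f (toℕ i) (iter f d x)   ≡⟨ sym (iter-+ f (toℕ i) d x) ⟩
      iter f (toℕ i + d) x          ≡⟨ cong (λ k → iter f k x) (trans (+-comm (toℕ i) d) (m∸n+n≡m (<⇒≤ i<j))) ⟩
      iter f (toℕ j) x              ≡⟨ sym iᵢ≡iⱼ ⟩
      iter f (toℕ i) x              ∎

  ⇝-bounded : ∀ {x y} → x ⇝ y → ∃ λ k → k < n × iter f k x ≡ y
  ⇝-bounded {x} (k , refl) with period x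
  ... | suc p , _ , p≤n , cycle =
    k % suc p , ≤-trans (m%n<n k (suc p)) p≤n ,
    (begin
      iter f (k % suc p) x                             ≡⟨ cong (iter f (k % suc p)) (sym (iter-* f cycle (k / suc p))) ⟩
      iter f (k % suc p) (iter f (k / suc p * suc p) x) ≡⟨ sym (iter-+ f (k % suc p) _ x) ⟩
      iter f (k % suc p + k / suc p * suc p) x          ≡⟨ cong (λ m → iter f m x) (m≡m%n+[m/n]*n k (suc p)) ⟨
      iter f k x                                        ∎)

  ⇝-back : ∀ x → f x ⇝ x
  ⇝-back x with suc p , _ , _ , cycle ← period x = p , trans (iter-suc f p x) cycle

  ⇝-fixed : ∀ {x y} → x ⇝ y → f y ≡ y → f x ≡ x
  ⇝-fixed {x} (k , refl) fixed = iter-injective k (trans (iter-suc f k x) fixed)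

  ⇝-invariant : {A : Set} (g : Fin n → A) → (∀ x → g (f x) ≡ g x) → ∀ {x y} → x ⇝ y → g y ≡ g x
  ⇝-invariant g g-f (zero , refl) = refl
  ⇝-invariant g g-f {x} (suc k , refl) = trans (g-f (iter f k x)) (⇝-invariant g g-f (k , refl))

  leader : Fin n → Fin n
  leader x = argmin toℕ x (applyUpTo (λ k → iter f k x) n)

  leader-≤ : ∀ {x y} → x ⇝ y → toℕ (leader x) ≤ toℕ y
  leader-≤ {x} x⇝y with k , k<n , refl ← ⇝-bounded x⇝y =
    All.lookup (f[argmin]≤f[xs] {f = toℕ} x (applyUpTo (λ k → iter f k x) n))
               (∈-applyUpTo⁺ (λ k → iter f k x) k<n)

  ⇝-leader : ∀ {x} → x ⇝ leader x
  ⇝-leader {x} =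
    argmin-all toℕ {P = x ⇝_} ⇝-refl (All.applyUpTo⁺₂ (λ k → iter f k x) n (λ k → k , refl))

  leader-cong : ∀ {x y} → x ⇝ y → y ⇝ x → leader x ≡ leader y
  leader-cong x⇝y y⇝x = toℕ-injective (≤-antisym
    (leader-≤ (⇝-trans x⇝y ⇝-leader))
    (leader-≤ (⇝-trans y⇝x ⇝-leader)))

  leader-f : ∀ x → leader (f x) ≡ leader x
  leader-f x = leader-cong (⇝-back x) ⇝-step

  leader-invariant : {A : Set} (g : Fin n → A) → (∀ x → g (f x) ≡ g x) → ∀ x → g (leader x) ≡ g x
  leader-invariant g g-f x = ⇝-invariant g g-f ⇝-leader

  -- Literally the predicate filtered in numCycles, so that numCycles f ≡ length leaders holds by refl.
  isLeader? : (i : Fin n) → Dec (f i ≢ i × (∀ (k : Fin n) → toℕ i ≤ toℕ (iter f (toℕ k) i)))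
  isLeader? i = ¬? (f i ≟ i) ×-dec all? (λ (k : Fin n) → toℕ i ≤? toℕ (iter f (toℕ k) i))

  leaders : List (Fin n)
  leaders = filter isLeader? (allFin n)

  leaders-unique : Unique leaders
  leaders-unique = Unique.filter⁺ isLeader? (Unique.allFin⁺ n)

  ∈leaders⇒moved : ∀ {r} → r ∈ leaders → f r ≢ r
  ∈leaders⇒moved r∈ = proj₁ (proj₂ (∈-filter⁻ isLeader? {xs = allFin n} r∈))

  ∈leaders⇒≤ : ∀ {r y} → r ∈ leaders → r ⇝ y → toℕ r ≤ toℕ y
  ∈leaders⇒≤ {r} r∈ r⇝y with k , k<n , refl ← ⇝-bounded r⇝y =
    subst (λ m → toℕ r ≤ toℕ (iter f m r)) (toℕ-fromℕ< k<n)
      (proj₂ (proj₂ (∈-filter⁻ isLeader? {xs = allFin n} r∈)) (fromℕ< k<n))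

  ∈leaders⇒leader≡ : ∀ {r} → r ∈ leaders → leader r ≡ r
  ∈leaders⇒leader≡ r∈ = toℕ-injective (≤-antisym (leader-≤ ⇝-refl) (∈leaders⇒≤ r∈ ⇝-leader))

  leader∈leaders : ∀ {x} → f x ≢ x → leader x ∈ leaders
  leader∈leaders moved = ∈-filter⁺ isLeader? (∈-allFin _)
    ( (λ fixed → moved (⇝-fixed ⇝-leader fixed))
    , (λ k → leader-≤ (⇝-trans ⇝-leader (toℕ k , refl))))

-- Boolean assignments on a list of keys

module Choices {A : Set} (_≟ᴬ_ : DecidableEquality A) where

  AgreeOn : List A → (A → Bool) → (A → Bool) → Set
  AgreeOn xs g h = ∀ {x} → x ∈ xs → g x ≡ h x

  DifferOn : List A → (A → Bool) → (A → Bool) → Set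
  DifferOn xs g h = ∃ λ x → x ∈ xs × g x ≢ h x

  update : A → Bool → (A → Bool) → A → Bool
  update a v g x = if does (x ≟ᴬ a) then v else g x

  update-same : ∀ a v g → update a v g a ≡ v
  update-same a v g = cong (if_then v else g a) (dec-true (a ≟ᴬ a) refl)

  update-other : ∀ {a x} v g → x ≢ a → update a v g x ≡ g x
  update-other {a} {x} v g x≢a = cong (if_then v else g x) (dec-false (x ≟ᴬ a) x≢a)

  choices : List A → List (A → Bool)
  choices [] = (λ _ → true) ∷ []
  choices (a ∷ as) = map (update a true) (choices as) ++ map (update a false) (choices as)

  length-choices : ∀ xs → length (choices xs) ≡ 2 ^ length xs
  length-choices [] = refl
  length-choices (a ∷ as) = begin
    length (map (update a true) cs ++ map (update a false) cs)         ≡⟨ length-++ (map (update a true) cs) ⟩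
    length (map (update a true) cs) + length (map (update a false) cs) ≡⟨ cong₂ _+_ (length-map _ cs) (length-map _ cs) ⟩
    length cs + length cs                                              ≡⟨ cong (λ m → m + m) (length-choices as) ⟩
    2 ^ length as + 2 ^ length as                                      ≡⟨ cong (2 ^ length as +_) (+-identityʳ _) ⟨
    2 ^ length (a ∷ as)                                                ∎
    where cs = choices as

  choices-differ : ∀ {xs} → Unique xs → AllPairs (DifferOn xs) (choices xs)
  choices-differ {[]} [] = All.[] ∷ []
  choices-differ {a ∷ as} (a∉as ∷ unique) =
    AllPairs.++⁺ (AllPairs.map⁺ (AllPairs.map (lift true) differ))
                 (AllPairs.map⁺ (AllPairs.map (lift false) differ))
                 (All.map⁺ (All.universal (λ g → All.map⁺ (All.universal (differ-at-a g) _)) _))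
    where
    differ = choices-differ unique
    lift : ∀ v {g h} → DifferOn as g h → DifferOn (a ∷ as) (update a v g) (update a v h)
    lift v {g} {h} (x , x∈ , gx≢hx) = x , there x∈ , λ eq →
      gx≢hx (trans (sym (update-other v g x≢a)) (trans eq (update-other v h x≢a)))
      where
      x≢a : x ≢ a
      x≢a x≡a = All.lookup a∉as x∈ (sym x≡a)
    differ-at-a : ∀ g h → DifferOn (a ∷ as) (update a true g) (update a false h)
    differ-at-a g h = a , here refl , λ eq →
      contradiction (trans (sym (update-same a true g)) (trans eq (update-same a false h))) λ ()

  update-agree : ∀ {a as v g h} → h a ≡ v → AgreeOn as g h → AgreeOn (a ∷ as) (update a v g) h
  update-agree {a} ha agree {x} x∈ with x ≟ᴬ a | x∈
  ... | yes refl | _ = sym ha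
  ... | no x≢a | here x≡a = contradiction x≡a x≢a
  ... | no _ | there x∈as = agree x∈as

  choices-complete : ∀ xs h → Any (λ g → AgreeOn xs g h) (choices xs)
  choices-complete [] h = here λ ()
  choices-complete (a ∷ as) h with h a in ha
  ... | true = Any.++⁺ˡ (Any.map⁺ (Any.map (update-agree ha) (choices-complete as h)))
  ... | false = Any.++⁺ʳ _ (Any.map⁺ (Any.map (update-agree ha) (choices-complete as h)))

-- Decompositions of P_σ₁ + P_σ₂

module Splitting (σ₁ σ₂ : Permutation′ n) where

  q : Fin n → Fin n
  q = quot σ₁ σ₂

  open Orbits q (⟨$⟩ʳ-injective (σ₂ ∘ₚ flip σ₁))
  open Choices {Fin n} _≟_

  σ₁∘q≡σ₂ : ∀ x → σ₁ ⟨$⟩ʳ q x ≡ σ₂ ⟨$⟩ʳ x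
  σ₁∘q≡σ₂ x = inverseʳ σ₁

  fixed⇒σ₁≡σ₂ : ∀ {x} → q x ≡ x → σ₁ ⟨$⟩ʳ x ≡ σ₂ ⟨$⟩ʳ x
  fixed⇒σ₁≡σ₂ {x} fixed = trans (cong (σ₁ ⟨$⟩ʳ_) (sym fixed)) (σ₁∘q≡σ₂ x)

  σ₁≡σ₂⇒fixed : ∀ {x} → σ₁ ⟨$⟩ʳ x ≡ σ₂ ⟨$⟩ʳ x → q x ≡ x
  σ₁≡σ₂⇒fixed eq = trans (cong (σ₁ ⟨$⟩ˡ_) (sym eq)) (inverseˡ σ₁)

  pick : Bool → Fin n → Fin n
  pick v x = if v then σ₁ ⟨$⟩ʳ x else σ₂ ⟨$⟩ʳ x

  unpick : Bool → Fin n → Fin n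
  unpick v y = if v then σ₁ ⟨$⟩ˡ y else σ₂ ⟨$⟩ˡ y

  pick-unpick : ∀ v y → pick v (unpick v y) ≡ y
  pick-unpick true y = inverseʳ σ₁
  pick-unpick false y = inverseʳ σ₂

  unpick-pick : ∀ v x → unpick v (pick v x) ≡ x
  unpick-pick true x = inverseˡ σ₁
  unpick-pick false x = inverseˡ σ₂

  pick-fixed : ∀ {x} → q x ≡ x → ∀ v w → pick v x ≡ pick w x
  pick-fixed fixed true true = refl
  pick-fixed fixed true false = fixed⇒σ₁≡σ₂ fixed
  pick-fixed fixed false true = sym (fixed⇒σ₁≡σ₂ fixed)
  pick-fixed fixed false false = refl

  pick-cong : ∀ {x v w} → (q x ≢ x → v ≡ w) → pick v x ≡ pick w x
  pick-cong {x} {v} {w} eq-if-moved with q x ≟ x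
  ... | yes fixed = pick-fixed fixed v w
  ... | no moved = cong (λ b → pick b x) (eq-if-moved moved)

  pick-injective : ∀ {x v w} → q x ≢ x → pick v x ≡ pick w x → v ≡ w
  pick-injective {v = true} {true} _ _ = refl
  pick-injective {v = true} {false} moved eq = contradiction (σ₁≡σ₂⇒fixed eq) moved
  pick-injective {v = false} {true} moved eq = contradiction (σ₁≡σ₂⇒fixed (sym eq)) moved
  pick-injective {v = false} {false} _ _ = refl

  δ-pick : ∀ v i j → δ i (pick v j) + δ i (pick (not v) j) ≡ δ i (σ₁ ⟨$⟩ʳ j) + δ i (σ₂ ⟨$⟩ʳ j)
  δ-pick true i j = refl
  δ-pick false i j = +-comm (δ i (σ₂ ⟨$⟩ʳ j)) (δ i (σ₁ ⟨$⟩ʳ j))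

  record Selects (τ₁ τ₂ : Permutation′ n) : Set where
    field
      side : Fin n → Bool
      τ₁-side : ∀ j → τ₁ ⟨$⟩ʳ j ≡ pick (side j) j
      τ₂-side : ∀ j → τ₂ ⟨$⟩ʳ j ≡ pick (not (side j)) j

  open Selects

  column-choice : ∀ {τ₁ τ₂} → PSum σ₁ σ₂ ≐ PSum τ₁ τ₂ →
    ∀ j → ∃ λ v → τ₁ ⟨$⟩ʳ j ≡ pick v j × τ₂ ⟨$⟩ʳ j ≡ pick (not v) j
  column-choice {τ₁} {τ₂} H j with δ-sum-injective columns
    where
    columns : ∀ i → δ i (τ₁ ⟨$⟩ʳ j) + δ i (τ₂ ⟨$⟩ʳ j) ≡ δ i (σ₁ ⟨$⟩ʳ j) + δ i (σ₂ ⟨$⟩ʳ j)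
    columns i = begin
      δ i (τ₁ ⟨$⟩ʳ j) + δ i (τ₂ ⟨$⟩ʳ j)   ≡⟨ PSum≡δ+δ τ₁ τ₂ i j ⟨
      PSum τ₁ τ₂ i j                      ≡⟨ H i j ⟨
      PSum σ₁ σ₂ i j                      ≡⟨ PSum≡δ+δ σ₁ σ₂ i j ⟩
      δ i (σ₁ ⟨$⟩ʳ j) + δ i (σ₂ ⟨$⟩ʳ j)   ∎
  ... | inj₁ (τ₁j , τ₂j) = true , τ₁j , τ₂j
  ... | inj₂ (τ₁j , τ₂j) = false , τ₁j , τ₂j

  ≐⇒Selects : ∀ {τ₁ τ₂} → PSum σ₁ σ₂ ≐ PSum τ₁ τ₂ → Selects τ₁ τ₂
  ≐⇒Selects H = record
    { side = λ j → proj₁ (column-choice H j)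
    ; τ₁-side = λ j → proj₁ (proj₂ (column-choice H j))
    ; τ₂-side = λ j → proj₂ (proj₂ (column-choice H j))
    }

  Selects⇒≐ : ∀ {τ₁ τ₂} → Selects τ₁ τ₂ → PSum τ₁ τ₂ ≐ PSum σ₁ σ₂
  Selects⇒≐ {τ₁} {τ₂} S i j = begin
    PSum τ₁ τ₂ i j                                    ≡⟨ PSum≡δ+δ τ₁ τ₂ i j ⟩
    δ i (τ₁ ⟨$⟩ʳ j) + δ i (τ₂ ⟨$⟩ʳ j)                 ≡⟨ cong₂ _+_ (cong (δ i) (τ₁-side S j)) (cong (δ i) (τ₂-side S j)) ⟩
    δ i (pick v j) + δ i (pick (not v) j)             ≡⟨ δ-pick v i j ⟩
    δ i (σ₁ ⟨$⟩ʳ j) + δ i (σ₂ ⟨$⟩ʳ j)                 ≡⟨ PSum≡δ+δ σ₁ σ₂ i j ⟨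
    PSum σ₁ σ₂ i j                                    ∎
    where v = side S j

  module _ (b : Fin n → Bool) (b-q : ∀ x → b (q x) ≡ b x) where

    b-unpick : ∀ v y → b (unpick v y) ≡ b (σ₁ ⟨$⟩ˡ y)
    b-unpick true y = refl
    b-unpick false y = begin
      b (σ₂ ⟨$⟩ˡ y)                       ≡⟨ b-q (σ₂ ⟨$⟩ˡ y) ⟨
      b (σ₁ ⟨$⟩ˡ (σ₂ ⟨$⟩ʳ (σ₂ ⟨$⟩ˡ y)))   ≡⟨ cong (λ z → b (σ₁ ⟨$⟩ˡ z)) (inverseʳ σ₂) ⟩
      b (σ₁ ⟨$⟩ˡ y)                       ∎

    b-unpick-pick : ∀ v x → b (σ₁ ⟨$⟩ˡ pick v x) ≡ b x
    b-unpick-pick true x = cong b (inverseˡ σ₁)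
    b-unpick-pick false x = b-q x

    glue : Permutation′ n
    glue = permutation (λ x → pick (b x) x) (λ y → unpick (b (σ₁ ⟨$⟩ˡ y)) y)
      (λ y → let v = b (σ₁ ⟨$⟩ˡ y) in trans (cong (λ w → pick w (unpick v y)) (b-unpick v y)) (pick-unpick v y))
      (λ x → let v = b x in trans (cong (λ w → unpick w (pick v x)) (b-unpick-pick v x)) (unpick-pick v x))

  merged : (Fin n → Bool) → Permutation′ n
  merged g = glue (g ∘ leader) (λ x → cong g (leader-f x))

  mergedPair : (Fin n → Bool) → Permutation′ n × Permutation′ n
  mergedPair g = merged g , merged (not ∘ g)

  merged-Selects : ∀ g → Selects (merged g) (merged (not ∘ g))
  merged-Selects g = record { side = g ∘ leader ; τ₁-side = λ _ → refl ; τ₂-side = λ _ → refl }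

  merged-distinct : ∀ {g h} → DifferOn leaders g h → ¬ SamePair (mergedPair g) (mergedPair h)
  merged-distinct {g} {h} (r , r∈ , gr≢hr) (same , _) = gr≢hr (begin
    g r            ≡⟨ cong g (∈leaders⇒leader≡ r∈) ⟨
    g (leader r)   ≡⟨ pick-injective {r} (∈leaders⇒moved r∈) (same r) ⟩
    h (leader r)   ≡⟨ cong h (∈leaders⇒leader≡ r∈) ⟩
    h r            ∎)

  side-consistent : ∀ {τ₁ τ₂ j v w} → q j ≢ j →
    τ₁ ⟨$⟩ʳ j ≡ pick v j → τ₂ ⟨$⟩ʳ j ≡ pick (not v) j →
    τ₁ ⟨$⟩ʳ q j ≡ pick w (q j) → τ₂ ⟨$⟩ʳ q j ≡ pick (not w) (q j) → w ≡ v
  side-consistent {v = true} {true} _ _ _ _ _ = refl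
  side-consistent {v = false} {false} _ _ _ _ _ = refl
  side-consistent {τ₂ = τ₂} {j} {true} {false} moved _ τ₂j _ τ₂qj =
    contradiction (⟨$⟩ʳ-injective τ₂ (trans τ₂qj (trans (σ₁∘q≡σ₂ j) (sym τ₂j)))) moved
  side-consistent {τ₁} {j = j} {false} {true} moved τ₁j _ τ₁qj _ =
    contradiction (⟨$⟩ʳ-injective τ₁ (trans τ₁qj (trans (σ₁∘q≡σ₂ j) (sym τ₁j)))) moved

  module _ {τ₁ τ₂ : Permutation′ n} (S : Selects τ₁ τ₂) where

    side-q : ∀ j → side S (q j) ≡ side S j
    side-q j with q j ≟ j
    ... | yes fixed = cong (side S) fixed
    ... | no moved = side-consistent {τ₁} {τ₂} moved
                       (τ₁-side S j) (τ₂-side S j) (τ₁-side S (q j)) (τ₂-side S (q j))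

    Selects⇒merged : ∀ {g} → AgreeOn leaders g (side S) → SamePair (τ₁ , τ₂) (mergedPair g)
    Selects⇒merged {g} agree =
      (λ x → trans (τ₁-side S x) (pick-cong {x} (side≡ x))) ,
      (λ x → trans (τ₂-side S x) (pick-cong {x} (cong not ∘ side≡ x)))
      where
      side≡ : ∀ x → q x ≢ x → side S x ≡ g (leader x)
      side≡ x moved =
        trans (sym (leader-invariant (side S) side-q x)) (sym (agree (leader∈leaders moved)))

  exactlyWays : ExactlyWays (2 ^ numCycles q) (PSum σ₁ σ₂)
  exactlyWays = map mergedPair (choices leaders)
    , trans (length-map mergedPair (choices leaders)) (length-choices leaders)
    , All.map⁺ (All.universal (λ g → Selects⇒≐ (merged-Selects g)) _)
    , AllPairs.map⁺ (AllPairs.map merged-distinct (choices-differ leaders-unique))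
    , λ τ₁ τ₂ H → let S = ≐⇒Selects (≐-sym H) in
        Any.map⁺ (Any.map (λ {g} → Selects⇒merged S {g}) (choices-complete leaders (side S)))

  σ₁≈merged⇒true : ∀ {g r} → σ₁ ≈ₚ merged g → r ∈ leaders → g r ≡ true
  σ₁≈merged⇒true {g} {r} same r∈ =
    trans (cong g (sym (∈leaders⇒leader≡ r∈))) (pick-injective (∈leaders⇒moved r∈) (sym (same r)))

  -- σ₁ on the cycle of r₂ and σ₂ on all others (that of r₁ in particular) is a third decomposition.
  two-leaders⇒¬US : ∀ {r₁ r₂} → r₁ ∈ leaders → r₂ ∈ leaders → r₁ ≢ r₂ → ¬ UniquelySummable σ₁ σ₂
  two-leaders⇒¬US {r₁} {r₂} r₁∈ r₂∈ r₁≢r₂ US =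
    refute (US (merged g) (merged (not ∘ g)) (≐-sym (Selects⇒≐ (merged-Selects g))))
    where
    g : Fin n → Bool
    g x = does (x ≟ r₂)
    refute : (σ₁ ≈ₚ merged g × σ₂ ≈ₚ merged (not ∘ g)) ⊎ (σ₁ ≈ₚ merged (not ∘ g) × σ₂ ≈ₚ merged g) → ⊥
    refute (inj₁ (σ₁≈ , _)) =
      contradiction (trans (sym (σ₁≈merged⇒true {g} σ₁≈ r₁∈)) (dec-false (r₁ ≟ r₂) r₁≢r₂)) λ ()
    refute (inj₂ (σ₁≈ , _)) =
      contradiction (trans (sym (σ₁≈merged⇒true {not ∘ g} σ₁≈ r₂∈)) (cong not (dec-true (r₂ ≟ r₂) refl))) λ ()

  US⇒numCycles≡1 : ¬ σ₁ ≈ₚ σ₂ → UniquelySummable σ₁ σ₂ → numCycles q ≡ 1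
  US⇒numCycles≡1 σ₁≉σ₂ US with j , σ₁j≢σ₂j ← ¬∀⟶∃¬ n _ (λ x → σ₁ ⟨$⟩ʳ x ≟ σ₂ ⟨$⟩ʳ x) σ₁≉σ₂ =
    length≡1 leaders-unique (leader∈leaders (σ₁j≢σ₂j ∘ fixed⇒σ₁≡σ₂))
      (λ r₁∈ r₂∈ r₁≢r₂ → two-leaders⇒¬US r₁∈ r₂∈ r₁≢r₂ US)

  merged-const-trivial : ∀ {τ₁ τ₂} v → SamePair (τ₁ , τ₂) (mergedPair (λ _ → v)) →
    (σ₁ ≈ₚ τ₁ × σ₂ ≈ₚ τ₂) ⊎ (σ₁ ≈ₚ τ₂ × σ₂ ≈ₚ τ₁)
  merged-const-trivial true (τ₁≈ , τ₂≈) = inj₁ ((λ x → sym (τ₁≈ x)) , (λ x → sym (τ₂≈ x)))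
  merged-const-trivial false (τ₁≈ , τ₂≈) = inj₂ ((λ x → sym (τ₂≈ x)) , (λ x → sym (τ₁≈ x)))

  numCycles≡1⇒US : numCycles q ≡ 1 → UniquelySummable σ₁ σ₂
  numCycles≡1⇒US one τ₁ τ₂ H with r , only ← length≡1⇒singleton leaders one =
    merged-const-trivial {τ₁} {τ₂} (side S r)
      (Selects⇒merged S {λ _ → side S r} (λ r′∈ → cong (side S) (sym (only r′∈))))
    where
    S = ≐⇒Selects H

theorem4p2 : (n : ℕ) → 2 ≤ n → (σ₁ σ₂ : Permutation′ n) → ¬ (σ₁ ≈ₚ σ₂) →
    (UniquelySummable σ₁ σ₂ ⇔ numCycles (quot σ₁ σ₂) ≡ 1)
    × ExactlyWays (2 ^ numCycles (quot σ₁ σ₂)) (PSum σ₁ σ₂)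
theorem4p2 n _ σ₁ σ₂ σ₁≉σ₂ = mk⇔ (US⇒numCycles≡1 σ₁≉σ₂) numCycles≡1⇒US , exactlyWays
  where open Splitting σ₁ σ₂
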